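{- Consider a run of GFtP on a WMST-instance $(G,\hat w,w)$ with any arrival order, and let $T_{\mathrm{FtP}}$ be the initial tree. At any moment of the run, let $T$ be the current tree and $U$ the current set of unseen edges. If $e\in T_{\mathrm{FtP}}\cap U$ and $e'\notin T$ is an edge such that the unique cycle in $T\cup\{e'\}$ contains $e$, then $\hat w(e)\le\hat w(e')$.
   Context: A WMST-instance is a triple $(G,\hat w,w)$ with $G=(V,E)$ a finite simple connected undirected graph and $\hat w,w\colon E\to\mathbb{R}^+$ predicted and true edge weights. The algorithm knows $G$ and $\hat w$ in advance; the true weights arrive one by one as pairs $(w(e),e)$, each edge once. Algorithm GFtP: initially let $T$ be a minimum spanning tree of $G$ w.r.t. $\hat w$ (denoted $T_{\mathrm{FtP}}$) and $U=E$ (the unseen edges). Upon arrival of $(w(e_i),e_i)$: set $U:=U\setminus\{e_i\}$. If $e_i\in T$, accept $e_i$. Otherwise let $C$ be the cycle $e_i$ creates in $T\cup\{e_i\}$ and $C'=U\cap C$; if $C'\ne\emptyset$, let $e_{\max}$ be an edge of $C'$ of maximum $\hat w$; if $w(e_i)\le\hat w(e_{\max})$, set $T:=(T\setminus\{e_{\max}\})\cup\{e_i\}$ and accept $e_i$. Otherwise reject $e_i$.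
   Formalization: The predicted and true edge weights $\hat w$ and $w$ take positive rational values instead of values in $\mathbb{R}^+$. -}

module Defs where

open import Data.Nat using (ℕ; zero; suc; _<_)
open import Data.Fin using (Fin; fromℕ<)
open import Data.Fin.Subset using (Subset; _∈_; _∉_; _-_; _∪_; ⁅_⁆; ⊤)
open import Data.Fin.Subset.Properties using (_∈?_)
open import Data.List using (List; []; _∷_; foldr; map; filter)
open import Data.List.Membership.Propositional using () renaming (_∈_ to _∈ₗ_)
open import Data.List.Relation.Unary.Unique.Propositional using (Unique)
open import Data.Product using (Σ; _×_; _,_; proj₁; proj₂; ∃)
open import Data.Sum using (_⊎_)
open import Data.Rational using (ℚ; 0ℚ; _+_; _≤_)
open import Data.Vec.Functional using () renaming (toList to toListF)
open import Relation.Binary.PropositionalEquality using (_≡_; _≢_)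
open import Relation.Nullary using (¬_)
open import Data.List using (allFin)

Joins : ∀ {n m} → (Fin m → Fin n × Fin n) → Fin m → Fin n → Fin n → Set
Joins ends i u v = ends i ≡ (u , v) ⊎ ends i ≡ (v , u)

record SimpleGraph (n m : ℕ) : Set where
  field
    ends     : Fin m → Fin n × Fin n
    loopless : ∀ i → proj₁ (ends i) ≢ proj₂ (ends i)
    noMulti  : ∀ i j u v → Joins ends i u v → Joins ends j u v → i ≡ j
open SimpleGraph public

module _ {n m : ℕ} (G : SimpleGraph n m) where

  data Walk (S : Subset m) : Fin n → Fin n → List (Fin m) → List (Fin n) → Set where
    nil  : ∀ {u} → Walk S u u [] (u ∷ [])
    cons : ∀ {u w v e es vs} → e ∈ S → Joins (ends G) e u w →
           Walk S w v es vs → Walk S u v (e ∷ es) (u ∷ vs)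

  Path : Subset m → Fin n → Fin n → List (Fin m) → Set
  Path S u v es = Σ (List (Fin n)) λ vs → Walk S u v es vs × Unique vs

  Connected : Set
  Connected = ∀ u v → ∃ λ es → Path ⊤ u v es

  IsSpanningTree : Subset m → Set
  IsSpanningTree S = ∀ u v → (∃ λ es → Path S u v es) ×
                             (∀ es es' → Path S u v es → Path S u v es' → es ≡ es')

  weight : (Fin m → ℚ) → Subset m → ℚ
  weight c S = foldr _+_ 0ℚ (map c (filter (_∈? S) (allFin m)))

  IsMST : (Fin m → ℚ) → Subset m → Set
  IsMST c S = IsSpanningTree S × (∀ S' → IsSpanningTree S' → weight c S ≤ weight c S')

  -- f lies on the unique cycle created in T ∪ {e} (for e ∉ T, T a spanning tree):
  -- either f = e or f lies on the path in T between the endpoints of e.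
  OnCycle : Subset m → Fin m → Fin m → Set
  OnCycle T e f = f ≡ e ⊎
    (∃ λ es → Path T (proj₁ (ends G e)) (proj₂ (ends G e)) es × f ∈ₗ es)

  -- One step of GFtP: state (T , U), arriving edge e with true weight w e,
  -- resulting state (T' , U').  All tie-breaking choices of e_max are allowed.
  data Step (ŵ w : Fin m → ℚ) (T U : Subset m) (e : Fin m) : Subset m → Subset m → Set where
    acceptTree : e ∈ T → Step ŵ w T U e T (U - e)
    acceptSwap : ∀ emax → e ∉ T →
                 emax ∈ (U - e) → OnCycle T e emax →
                 (∀ f → f ∈ (U - e) → OnCycle T e f → ŵ f ≤ ŵ emax) →
                 w e ≤ ŵ emax →
                 Step ŵ w T U e ((T - emax) ∪ ⁅ e ⁆) (U - e)
    rejectEmpty : e ∉ T →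
                 (∀ f → f ∈ (U - e) → ¬ OnCycle T e f) →
                 Step ŵ w T U e T (U - e)
    rejectHeavy : ∀ emax → e ∉ T →
                 emax ∈ (U - e) → OnCycle T e emax →
                 (∀ f → f ∈ (U - e) → OnCycle T e f → ŵ f ≤ ŵ emax) →
                 ¬ (w e ≤ ŵ emax) →
                 Step ŵ w T U e T (U - e)

  -- Run ŵ w π T₀ k T U : with arrival order π (the i-th arriving edge is π i),
  -- starting from the initial tree T₀ (an MST w.r.t. ŵ) and U = E, after k
  -- arrivals the current tree is T and the current unseen set is U.
  data Run (ŵ w : Fin m → ℚ) (π : Fin m → Fin m) (T₀ : Subset m) :
           ℕ → Subset m → Subset m → Set where
    start : IsMST ŵ T₀ → Run ŵ w π T₀ 0 T₀ ⊤
    step  : ∀ {k T U T' U'} → Run ŵ w π T₀ k T U → (p : k < m) →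
            Step ŵ w T U (π (fromℕ< p)) T' U' → Run ŵ w π T₀ (suc k) T' U'

{-# OPTIONS --safe #-}

-- The run maintains the invariant that every unseen edge e of the current tree T is
-- lightest (w.r.t. ŵ) across its fundamental cut, i.e. there is no detour around e: no
-- walk between its ends through T − e and non-tree edges lighter than e.  Initially this
-- is the cut property of the minimum spanning tree T₀, since exchanging e for a lighter
-- edge across its cut would give a lighter spanning tree.  Only a swap T′ = T − f + g
-- changes the tree.  For e off the cycle of g, a detour around e in T′ can reroute g along
-- that cycle.  For e on the cycle, ŵ e ≤ ŵ f by the choice of f, and a detour around e in
-- T′ yields one around f in T.  Finally, if e lies on the cycle of a non-tree edge e′ with
-- ŵ e′ < ŵ e, the rest of that cycle is a detour around e.
module Submission where

open import Defs
open import Algebra.Bundles using (CommutativeMonoid)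
open import Data.Bool using (if_then_else_)
open import Data.Empty using (⊥-elim)
open import Data.Fin using (Fin; zero; suc)
open import Data.Fin.Properties using (_≟_; punchInᵢ≢i)
open import Data.Fin.Subset using (Subset; _∈_; _∉_; _-_; _∪_; ⁅_⁆) renaming (_⊆_ to _⊆ˢ_)
open import Data.Fin.Subset.Properties
  using (_∈?_; drop-there; p─q⊆p; x∈p∧x≢y⇒x∈p-y; x∈p∪q⁻; x∈p∪q⁺; x∈⁅y⁆⇒x≡y; x∈⁅x⁆; ⊆-antisym)
open import Data.List using (List; []; _∷_; foldr; map; filter; tabulate)
open import Data.List.Membership.Propositional using () renaming (_∈_ to _∈ₗ_; _∉_ to _∉ₗ_)
open import Data.List.Relation.Binary.Subset.Propositional using () renaming (_⊆_ to _⊆ₗ_)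
open import Data.List.Relation.Unary.All using ([]; _∷_)
open import Data.List.Relation.Unary.All.Properties using (¬Any⇒All¬)
open import Data.List.Relation.Unary.AllPairs using ([]; _∷_)
open import Data.List.Relation.Unary.Any using (here; there; any?)
open import Data.List.Relation.Unary.Unique.Propositional using (Unique)
open import Data.List.Relation.Unary.Unique.Propositional.Properties using (Unique[x∷xs]⇒x∉xs)
open import Data.Nat using (ℕ; zero; suc)
open import Data.Product using (_×_; _,_; proj₁; proj₂; ∃; ∃₂)
open import Data.Vec using (_∷_)
open import Data.Vec.Functional using (removeAt)
open import Data.Rational using (ℚ; 0ℚ; _+_; _<_; _≤_)
open import Data.Rational.Properties
  using ( ≤-refl; ≮⇒≥; <-irrefl; <-≤-trans; +-monoʳ-<; +-monoˡ-≤; +-identityˡ; +-identityʳ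
        ; +-0-commutativeMonoid; module ≤-Reasoning)
open import Algebra.Properties.CommutativeMonoid.Sum +-0-commutativeMonoid using (sum; sum-remove; sum-cong-≗)
open import Algebra.Properties.CommutativeSemigroup (CommutativeMonoid.commutativeSemigroup +-0-commutativeMonoid)
  using (xy∙z≈zy∙x; xy∙z≈xz∙y)
open import Data.Sum using (_⊎_; inj₁; inj₂; [_,_]′; map₁)
open import Function using (_∘_; id)
open import Function.Definitions using (Injective)
open import Level using (0ℓ)
open import Relation.Binary.Construct.Closure.ReflexiveTransitive
  using (Star; ε; _◅_; _◅◅_; kleisliStar; reverse; return) renaming (map to Star-map)
open import Relation.Binary.PropositionalEquality
  using (_≡_; _≢_; refl; sym; trans; cong; cong₂; subst; module ≡-Reasoning)
open import Relation.Nullary using (¬_; yes; no; does)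
open import Relation.Unary using (Pred; _⊆_; _∩_)

x∉p-x : ∀ {k} (p : Subset k) x → x ∉ p - x
x∉p-x (_ ∷ p) zero    ()
x∉p-x (_ ∷ p) (suc x) = x∉p-x p x ∘ drop-there

x∈p-y⇒x∈p : ∀ {k} {p : Subset k} {x y} → x ∈ p - y → x ∈ p
x∈p-y⇒x∈p {p = p} {y = y} = p─q⊆p p ⁅ y ⁆

x∈p-y⇒x≢y : ∀ {k} {p : Subset k} {x y} → x ∈ p - y → x ≢ y
x∈p-y⇒x≢y {p = p} x∈p-x refl = x∉p-x p _ x∈p-x

x∈p-y∪⁅z⁆⁻ : ∀ {k} {p : Subset k} {x y z} → x ∈ (p - y) ∪ ⁅ z ⁆ → (x ∈ p × x ≢ y) ⊎ x ≡ z
x∈p-y∪⁅z⁆⁻ {p = p} {y = y} {z} x∈ with x∈p∪q⁻ (p - y) ⁅ z ⁆ x∈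
... | inj₁ x∈p-y = inj₁ (x∈p-y⇒x∈p x∈p-y , x∈p-y⇒x≢y x∈p-y)
... | inj₂ x∈⁅z⁆ = inj₂ (x∈⁅y⁆⇒x≡y z x∈⁅z⁆)

x∈p-y∪⁅z⁆⁺ : ∀ {k} {p : Subset k} {x y z} → (x ∈ p × x ≢ y) ⊎ x ≡ z → x ∈ (p - y) ∪ ⁅ z ⁆
x∈p-y∪⁅z⁆⁺     (inj₁ (x∈p , x≢y)) = x∈p∪q⁺ (inj₁ (x∈p∧x≢y⇒x∈p-y x∈p x≢y))
x∈p-y∪⁅z⁆⁺ {z = z} (inj₂ refl)    = x∈p∪q⁺ (inj₂ (x∈⁅x⁆ z))

x∉p-y∪⁅z⁆⇒x≡y : ∀ {k} {p : Subset k} {x y z} → x ∉ (p - y) ∪ ⁅ z ⁆ → x ∈ p → x ≡ y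
x∉p-y∪⁅z⁆⇒x≡y {x = x} {y} x∉ x∈p with x ≟ y
... | yes x≡y = x≡y
... | no x≢y  = ⊥-elim (x∉ (x∈p-y∪⁅z⁆⁺ (inj₁ (x∈p , x≢y))))

p∪⁅x⁆-x≡p : ∀ {k} {p : Subset k} {x} → x ∉ p → (p ∪ ⁅ x ⁆) - x ≡ p
p∪⁅x⁆-x≡p {p = p} {x} x∉p = ⊆-antisym shrink grow
  where
  shrink : (p ∪ ⁅ x ⁆) - x ⊆ˢ p
  shrink y∈ with x∈p∪q⁻ p ⁅ x ⁆ (x∈p-y⇒x∈p y∈)
  ... | inj₁ y∈p   = y∈p
  ... | inj₂ y∈⁅x⁆ = ⊥-elim (x∈p-y⇒x≢y y∈ (x∈⁅y⁆⇒x≡y x y∈⁅x⁆))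
  grow : p ⊆ˢ (p ∪ ⁅ x ⁆) - x
  grow y∈p = x∈p∧x≢y⇒x∈p-y (x∈p∪q⁺ (inj₁ y∈p)) λ { refl → x∉p y∈p }

sum-update : ∀ {k} (f h : Fin k → ℚ) (i : Fin k) → (∀ j → j ≢ i → f j ≡ h j) →
             sum f + h i ≡ sum h + f i
sum-update {suc k} f h i agree = begin
  sum f + h i                       ≡⟨ cong (_+ h i) (sum-remove {i = i} f) ⟩
  (f i + sum (removeAt f i)) + h i  ≡⟨ cong (λ r → (f i + r) + h i) (sum-cong-≗ (agree _ ∘ punchInᵢ≢i i)) ⟩
  (f i + sum (removeAt h i)) + h i  ≡⟨ xy∙z≈zy∙x (f i) _ (h i) ⟩
  (h i + sum (removeAt h i)) + f i  ≡⟨ cong (_+ f i) (sum-remove {i = i} h) ⟨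
  sum h + f i                       ∎
  where open ≡-Reasoning

module _ {n m : ℕ} (G : SimpleGraph n m) where

  EdgeSet : Set₁
  EdgeSet = Pred (Fin m) 0ℓ

  _-ₑ_ : EdgeSet → Fin m → EdgeSet
  (P -ₑ e) g = P g × g ≢ e

  _+ₑ_ : EdgeSet → Fin m → EdgeSet
  (P +ₑ e) g = P g ⊎ g ≡ e

  joins : Fin m → Fin n → Fin n → Set
  joins = Joins (ends G)

  Adjacent : EdgeSet → Fin n → Fin n → Set
  Adjacent P u v = ∃ λ g → P g × joins g u v

  Reach : EdgeSet → Fin n → Fin n → Set
  Reach P = Star (Adjacent P)

  private variable
    a b c d u v w x y : Fin n
    e f g h : Fin m
    S T U : Subset m
    P Q : EdgeSet
    es : List (Fin m)
    vs : List (Fin n)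

  joins-sym : joins g u v → joins g v u
  joins-sym (inj₁ eq) = inj₂ eq
  joins-sym (inj₂ eq) = inj₁ eq

  joins-ends : joins g u v → joins g a b → (a ≡ u × b ≡ v) ⊎ (a ≡ v × b ≡ u)
  joins-ends (inj₁ p) (inj₁ q) with trans (sym q) p
  ... | refl = inj₁ (refl , refl)
  joins-ends (inj₁ p) (inj₂ q) with trans (sym q) p
  ... | refl = inj₂ (refl , refl)
  joins-ends (inj₂ p) (inj₁ q) with trans (sym q) p
  ... | refl = inj₂ (refl , refl)
  joins-ends (inj₂ p) (inj₂ q) with trans (sym q) p
  ... | refl = inj₁ (refl , refl)

  joins-other : joins g u v → joins g u w → w ≡ v
  joins-other j j′ with joins-ends j j′
  ... | inj₁ (_ , w≡v)   = w≡v
  ... | inj₂ (u≡v , w≡u) = trans w≡u u≡v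

  joins-irrefl : joins g u v → u ≢ v
  joins-irrefl (inj₁ eq) refl = loopless G _ (trans (cong proj₁ eq) (sym (cong proj₂ eq)))
  joins-irrefl (inj₂ eq) refl = loopless G _ (trans (cong proj₁ eq) (sym (cong proj₂ eq)))

  Reach-mono : P ⊆ Q → Reach P u v → Reach Q u v
  Reach-mono P⊆Q = Star-map λ { (g , pg , j) → g , P⊆Q pg , j }

  Reach-sym : Reach P u v → Reach P v u
  Reach-sym = reverse λ { (g , pg , j) → g , pg , joins-sym j }

  Reach-at-ends : joins g x y → Reach P x y → joins g u v → Reach P u v
  Reach-at-ends j r j′ with joins-ends j j′
  ... | inj₁ (refl , refl) = r
  ... | inj₂ (refl , refl) = Reach-sym r

  Reach-absorb : joins g x y → Reach P x y → Reach (P +ₑ g) u v → Reach P u v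
  Reach-absorb j r = kleisliStar id λ where
    (h , inj₁ ph , j′)   → return (h , ph , j′)
    (h , inj₂ refl , j′) → Reach-at-ends j r j′

  Reach-through : Reach (P +ₑ g) u v →
                  Reach P u v ⊎ ∃₂ λ x y → joins g x y × Reach P u x × Reach P y v
  Reach-through ε = inj₁ ε
  Reach-through ((h , inj₁ ph , j) ◅ r) with Reach-through r
  ... | inj₁ r′                     = inj₁ ((h , ph , j) ◅ r′)
  ... | inj₂ (x , y , jg , ux , yv) = inj₂ (x , y , jg , (h , ph , j) ◅ ux , yv)
  Reach-through ((h , inj₂ refl , j) ◅ r) with Reach-through r
  ... | inj₁ r′ = inj₂ (_ , _ , j , ε , r′)
  ... | inj₂ (x , y , jg , _ , yv) with joins-ends j jg
  ...   | inj₁ (refl , refl) = inj₂ (_ , _ , j , ε , yv)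
  ...   | inj₂ (refl , refl) = inj₁ yv

  Reach-exchange : joins h u v → joins g x y → Reach (P +ₑ g) u v → ¬ Reach P u v →
                   Reach (P +ₑ h) x y
  Reach-exchange jh jg r ¬r with Reach-through r
  ... | inj₁ r′ = ⊥-elim (¬r r′)
  ... | inj₂ (x′ , y′ , jg′ , ux′ , y′v) =
    Reach-at-ends jg′ (Reach-sym (Reach-mono inj₁ ux′) ◅◅ (_ , inj₂ refl , jh) ◅ Reach-sym (Reach-mono inj₁ y′v))
                  jg

  -- Double negation spares us deciding R at the edge where the walk leaves R.
  Reach-preserves-¬¬ : {R : Fin n → Set} → (∀ {g u w} → P g → joins g u w → R u → ¬ ¬ R w) →
                       Reach P a b → R a → ¬ ¬ R b
  Reach-preserves-¬¬ closed ε ra ¬ra = ¬ra ra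
  Reach-preserves-¬¬ closed ((_ , pg , j) ◅ r) ra ¬rb =
    closed pg j ra λ ru → Reach-preserves-¬¬ closed r ru ¬rb

  walk-edge∈ : Walk G S u v es vs → g ∈ₗ es → g ∈ S
  walk-edge∈ (cons g∈S _ _) (here refl) = g∈S
  walk-edge∈ (cons _ _ w)   (there k)   = walk-edge∈ w k

  walk-head∈ : Walk G S u v es vs → u ∈ₗ vs
  walk-head∈ nil          = here refl
  walk-head∈ (cons _ _ _) = here refl

  walk-last∈ : Walk G S u v es vs → v ∈ₗ vs
  walk-last∈ nil          = here refl
  walk-last∈ (cons _ _ w) = there (walk-last∈ w)

  walk-ends∈ : Walk G S u v es vs → g ∈ₗ es → joins g a b → a ∈ₗ vs
  walk-ends∈ (cons _ j w) (here refl) j′ with joins-ends j j′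
  ... | inj₁ (refl , _) = here refl
  ... | inj₂ (refl , _) = there (walk-head∈ w)
  walk-ends∈ (cons _ _ w) (there k) j′ = there (walk-ends∈ w k j′)

  walk⇒Reach : Walk G S u v es vs → (∀ {g} → g ∈ S → g ∈ₗ es → P g) → Reach P u v
  walk⇒Reach nil            onP = ε
  walk⇒Reach (cons g∈S j w) onP = (_ , onP g∈S (here refl) , j) ◅ walk⇒Reach w λ h∈S k → onP h∈S (there k)

  walk⇒Reach-avoiding : Walk G S u v es vs → a ∉ₗ vs → joins h a b → Reach ((_∈ S) -ₑ h) u v
  walk⇒Reach-avoiding w a∉vs jh = walk⇒Reach w λ g∈S g∈es → g∈S , λ { refl → a∉vs (walk-ends∈ w g∈es jh) }

  walk-split : Walk G S x y es vs → Unique vs → h ∈ₗ es →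
               ∃₂ λ a b → joins h a b × Reach ((_∈ S) -ₑ h) x a × Reach ((_∈ S) -ₑ h) b y
  walk-split (cons _ j w) uniq (here refl) =
    _ , _ , j , ε , walk⇒Reach-avoiding w (Unique[x∷xs]⇒x∉xs uniq) j
  walk-split (cons g∈S j w) uniq@(_ ∷ uniq′) (there h∈es) =
    let a , b , jh , xa , by = walk-split w uniq′ h∈es
        g≢h = λ { refl → Unique[x∷xs]⇒x∉xs uniq (walk-ends∈ w h∈es j) }
    in a , b , jh , (_ , (g∈S , g≢h) , j) ◅ xa , by

  path-bypass : Walk G S x y es vs → Unique vs → h ∈ₗ es → ((_∈ S) -ₑ h) ⊆ P →
                Reach P x y → joins h c d → Reach P c d
  path-bypass w uniq h∈es S-h⊆P xy jh with walk-split w uniq h∈es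
  ... | a , b , jab , xa , by =
    Reach-at-ends jab (Reach-sym (Reach-mono S-h⊆P xa) ◅◅ xy ◅◅ Reach-sym (Reach-mono S-h⊆P by)) jh

  walk-suffix : Walk G S w v es vs → Unique vs → u ∈ₗ vs → ∃ λ es′ → Path G S u v es′ × es′ ⊆ₗ es
  walk-suffix nil            uniq        (here refl) = _ , (_ , nil , uniq) , id
  walk-suffix w@(cons _ _ _) uniq        (here refl) = _ , (_ , w , uniq) , id
  walk-suffix (cons _ _ w)   (_ ∷ uniq′) (there k)   =
    let es′ , path , es′⊆es = walk-suffix w uniq′ k in es′ , path , there ∘ es′⊆es

  Reach⇒Path : P ⊆ (_∈ S) → Reach P u v → ∃ λ es → Path G S u v es × (∀ {g} → g ∈ₗ es → P g)
  Reach⇒Path P⊆S ε = [] , (_ , nil , [] ∷ []) , λ ()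
  Reach⇒Path {u = u} P⊆S ((g , pg , j) ◅ r) with Reach⇒Path P⊆S r
  ... | es , (vs , w , uniq) , onP with any? (u ≟_) vs
  ...   | yes u∈vs = let es′ , path , es′⊆es = walk-suffix w uniq u∈vs in es′ , path , onP ∘ es′⊆es
  ...   | no u∉vs  = g ∷ es , (u ∷ vs , cons (P⊆S pg) j w , ¬Any⇒All¬ vs u∉vs ∷ uniq) ,
                     λ { (here refl) → pg ; (there k) → onP k }

  Acyclic : Subset m → Set
  Acyclic S = ∀ {h a b} → h ∈ S → joins h a b → ¬ Reach ((_∈ S) -ₑ h) a b

  acyclic-walk-unique : ∀ {es′ vs′} → Acyclic S → Walk G S u v es vs → Unique vs →
                        Walk G S u v es′ vs′ → Unique vs′ → es ≡ es′
  acyclic-walk-unique acyc nil _ nil _ = refl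
  acyclic-walk-unique acyc nil _ (cons _ _ w′) uniq′ = ⊥-elim (Unique[x∷xs]⇒x∉xs uniq′ (walk-last∈ w′))
  acyclic-walk-unique acyc (cons _ _ w) uniq nil _ = ⊥-elim (Unique[x∷xs]⇒x∉xs uniq (walk-last∈ w))
  acyclic-walk-unique acyc (cons {e = h} h∈S j w) uniq@(_ ∷ uniq₁) (cons {e = h′} h′∈S j′ w′) uniq′@(_ ∷ uniq₁′)
    with h ≟ h′
  ... | no h≢h′ =
    ⊥-elim (acyc h∈S j (Reach-sym (walk⇒Reach-avoiding w (Unique[x∷xs]⇒x∉xs uniq) j
                                  ◅◅ Reach-sym (walk⇒Reach-avoiding w′ (Unique[x∷xs]⇒x∉xs uniq′) j)
                                  ◅◅ return (h′ , (h′∈S , h≢h′ ∘ sym) , joins-sym j′))))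
  ... | yes refl with joins-other j′ j
  ...   | refl = cong (h ∷_) (acyclic-walk-unique acyc w uniq₁ w′ uniq₁′)

  spanning-tree-reach : IsSpanningTree G T → ∀ u v → Reach (_∈ T) u v
  spanning-tree-reach tree u v =
    let _ , _ , w , _ = proj₁ (tree u v) in walk⇒Reach w λ g∈T _ → g∈T

  spanning-tree⇒acyclic : IsSpanningTree G T → Acyclic T
  spanning-tree⇒acyclic tree {h} {a} {b} h∈T jh r =
    let es , path , avoids = Reach⇒Path proj₁ r
        es≡[h] = proj₂ (tree a b) es (h ∷ []) path single
    in proj₂ (avoids (subst (h ∈ₗ_) (sym es≡[h]) (here refl))) refl
    where
    single : Path G _ a b (h ∷ [])
    single = _ , cons h∈T jh nil , (joins-irrefl jh ∷ []) ∷ [] ∷ []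

  acyclic⇒spanning-tree : (∀ u v → Reach (_∈ S) u v) → Acyclic S → IsSpanningTree G S
  acyclic⇒spanning-tree spans acyc u v =
    (let es , path , _ = Reach⇒Path id (spans u v) in es , path) ,
    λ { _ _ (_ , w , uniq) (_ , w′ , uniq′) → acyclic-walk-unique acyc w uniq w′ uniq′ }

  exchange-spanning-tree : IsSpanningTree G T → e ∈ T → joins g u w → ¬ Reach ((_∈ T) -ₑ e) u w →
                           IsSpanningTree G ((T - e) ∪ ⁅ g ⁆)
  exchange-spanning-tree {T} {e} {g} tree e∈T jg cut = acyclic⇒spanning-tree spans acyclic
    where
    T′ : Subset m
    T′ = (T - e) ∪ ⁅ g ⁆
    T⊆T-e+e : (_∈ T) ⊆ (((_∈ T) -ₑ e) +ₑ e)
    T⊆T-e+e {h} h∈T with h ≟ e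
    ... | yes h≡e = inj₂ h≡e
    ... | no h≢e  = inj₁ (h∈T , h≢e)
    e-bypass : Reach (_∈ T′) (proj₁ (ends G e)) (proj₂ (ends G e))
    e-bypass = Reach-mono x∈p-y∪⁅z⁆⁺
      (Reach-exchange jg (inj₁ refl) (Reach-mono T⊆T-e+e (spanning-tree-reach tree _ _)) cut)
    spans : ∀ a b → Reach (_∈ T′) a b
    spans a b = Reach-absorb (inj₁ refl) e-bypass
      (Reach-mono (map₁ (x∈p-y∪⁅z⁆⁺ ∘ inj₁) ∘ T⊆T-e+e) (spanning-tree-reach tree a b))
    acyclic : Acyclic T′
    acyclic {h} h∈T′ jh r with x∈p-y∪⁅z⁆⁻ h∈T′
    ... | inj₂ refl = cut (Reach-at-ends jh (Reach-mono T′-g⊆T-e r) jg)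
      where
      T′-g⊆T-e : ((_∈ T′) -ₑ g) ⊆ ((_∈ T) -ₑ e)
      T′-g⊆T-e (x∈T′ , x≢g) = [ id , ⊥-elim ∘ x≢g ]′ (x∈p-y∪⁅z⁆⁻ x∈T′)
    -- A walk around h in T′ must use g, as T is acyclic; trading g for h joins u and w in T − e.
    ... | inj₁ (h∈T , h≢e) =
      cut (Reach-mono T-e-h+h⊆T-e (Reach-exchange jh jg (Reach-mono T′-h⊆T-e-h+g r)
            (spanning-tree⇒acyclic tree h∈T jh ∘ Reach-mono (λ ((x∈T , _) , x≢h) → x∈T , x≢h))))
      where
      T′-h⊆T-e-h+g : ((_∈ T′) -ₑ h) ⊆ ((((_∈ T) -ₑ e) -ₑ h) +ₑ g)
      T′-h⊆T-e-h+g (x∈T′ , x≢h) = map₁ (_, x≢h) (x∈p-y∪⁅z⁆⁻ x∈T′)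
      T-e-h+h⊆T-e : ((((_∈ T) -ₑ e) -ₑ h) +ₑ h) ⊆ ((_∈ T) -ₑ e)
      T-e-h+h⊆T-e (inj₁ (x∈T-e , _)) = x∈T-e
      T-e-h+h⊆T-e (inj₂ refl)        = h∈T , h≢e

  module _ (c : Fin m → ℚ) where

    indicator : Subset m → Fin m → ℚ
    indicator X i = if does (i ∈? X) then c i else 0ℚ

    indicator-∈ : g ∈ S → indicator S g ≡ c g
    indicator-∈ {g} {S} g∈S with g ∈? S
    ... | yes _  = refl
    ... | no g∉S = ⊥-elim (g∉S g∈S)

    indicator-∉ : g ∉ S → indicator S g ≡ 0ℚ
    indicator-∉ {g} {S} g∉S with g ∈? S
    ... | yes g∈S = ⊥-elim (g∉S g∈S)
    ... | no _    = refl

    indicator-cong : (g ∈ S → g ∈ T) → (g ∈ T → g ∈ S) → indicator S g ≡ indicator T g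
    indicator-cong {g} {S} {T} S⇒T T⇒S with g ∈? S | g ∈? T
    ... | yes _   | yes _   = refl
    ... | no _    | no _    = refl
    ... | yes g∈S | no g∉T  = ⊥-elim (g∉T (S⇒T g∈S))
    ... | no g∉S  | yes g∈T = ⊥-elim (g∉S (T⇒S g∈T))

    filter-weight : ∀ X {k} (f : Fin k → Fin m) →
                    foldr _+_ 0ℚ (map c (filter (_∈? X) (tabulate f))) ≡ sum (indicator X ∘ f)
    filter-weight X {zero}  f = refl
    filter-weight X {suc k} f with f zero ∈? X
    ... | yes _ = cong (c (f zero) +_) (filter-weight X (f ∘ suc))
    ... | no _  = trans (filter-weight X (f ∘ suc)) (sym (+-identityˡ _))

    weight-remove : g ∈ S → weight G c S ≡ weight G c (S - g) + c g
    weight-remove {g} {S} g∈S = begin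
      weight G c S                            ≡⟨ filter-weight S id ⟩
      sum (indicator S)                       ≡⟨ +-identityʳ _ ⟨
      sum (indicator S) + 0ℚ                  ≡⟨ cong (sum (indicator S) +_) (indicator-∉ (x∉p-x S g)) ⟨
      sum (indicator S) + indicator (S - g) g ≡⟨ sum-update (indicator S) (indicator (S - g)) g agree ⟩
      sum (indicator (S - g)) + indicator S g ≡⟨ cong₂ _+_ (sym (filter-weight (S - g) id)) (indicator-∈ g∈S) ⟩
      weight G c (S - g) + c g                ∎
      where
      open ≡-Reasoning
      agree : ∀ h → h ≢ g → indicator S h ≡ indicator (S - g) h
      agree h h≢g = indicator-cong (λ h∈S → x∈p∧x≢y⇒x∈p-y h∈S h≢g) x∈p-y⇒x∈p

    weight-exchange : e ∈ T → g ∉ T → weight G c ((T - e) ∪ ⁅ g ⁆) + c e ≡ weight G c T + c g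
    weight-exchange {e} {T} {g} e∈T g∉T = begin
      weight G c ((T - e) ∪ ⁅ g ⁆) + c e                ≡⟨ cong (_+ c e) (weight-remove (x∈p-y∪⁅z⁆⁺ (inj₂ refl))) ⟩
      weight G c (((T - e) ∪ ⁅ g ⁆) - g) + c g + c e    ≡⟨ cong (λ X → weight G c X + c g + c e) (p∪⁅x⁆-x≡p (g∉T ∘ x∈p-y⇒x∈p)) ⟩
      weight G c (T - e) + c g + c e                    ≡⟨ xy∙z≈xz∙y (weight G c (T - e)) (c g) (c e) ⟩
      weight G c (T - e) + c e + c g                    ≡⟨ cong (_+ c g) (weight-remove e∈T) ⟨
      weight G c T + c g                                ∎
      where open ≡-Reasoning

  module _ (ŵ : Fin m → ℚ) where

    Detour : Subset m → Fin m → EdgeSet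
    Detour T e g = (g ∈ T × g ≢ e) ⊎ (g ∉ T × ŵ g < ŵ e)

    LightestInCut : Subset m → Fin m → Set
    LightestInCut T e = ∀ {a b} → joins e a b → ¬ Reach (Detour T e) a b

    Invariant : Subset m → Subset m → Set
    Invariant T U = ∀ {e} → e ∈ T → e ∈ U → LightestInCut T e

    mst-exchange-bound : IsMST G ŵ T → e ∈ T → g ∉ T → joins g u w → ¬ Reach ((_∈ T) -ₑ e) u w →
                         ŵ e ≤ ŵ g
    mst-exchange-bound {T} {e} {g} (tree , minimal) e∈T g∉T jg cut = ≮⇒≥ λ g<e → <-irrefl refl (begin-strict
      weight G ŵ T + ŵ g   <⟨ +-monoʳ-< (weight G ŵ T) g<e ⟩
      weight G ŵ T + ŵ e   ≤⟨ +-monoˡ-≤ (ŵ e) (minimal T′ (exchange-spanning-tree tree e∈T jg cut)) ⟩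
      weight G ŵ T′ + ŵ e  ≡⟨ weight-exchange ŵ e∈T g∉T ⟩
      weight G ŵ T + ŵ g   ∎)
      where
      open ≤-Reasoning
      T′ : Subset m
      T′ = (T - e) ∪ ⁅ g ⁆

    mst-lightest-in-cut : IsMST G ŵ T → e ∈ T → LightestInCut T e
    mst-lightest-in-cut {T} {e} mst@(tree , _) e∈T {p} je r =
      Reach-preserves-¬¬ extend r ε (spanning-tree⇒acyclic tree e∈T je)
      where
      extend : ∀ {g u w} → Detour T e g → joins g u w →
               Reach ((_∈ T) -ₑ e) p u → ¬ ¬ Reach ((_∈ T) -ₑ e) p w
      extend (inj₁ g∈T-e) jg pu ¬pw = ¬pw (pu ◅◅ return (_ , g∈T-e , jg))
      extend (inj₂ (g∉T , g<e)) jg pu ¬pw =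
        <-irrefl refl (<-≤-trans g<e (mst-exchange-bound mst e∈T g∉T jg λ uw → ¬pw (pu ◅◅ uw)))

    Detour-swap-⊆ : f ∈ T → e ≢ f → Detour ((T - f) ∪ ⁅ g ⁆) e ⊆ (Detour T e +ₑ g)
    Detour-swap-⊆ f∈T e≢f (inj₁ (h∈T′ , h≢e)) with x∈p-y∪⁅z⁆⁻ h∈T′
    ... | inj₁ (h∈T , _) = inj₁ (inj₁ (h∈T , h≢e))
    ... | inj₂ h≡g       = inj₂ h≡g
    Detour-swap-⊆ {T = T} f∈T e≢f {h} (inj₂ (h∉T′ , h<e)) with h ∈? T
    ... | yes h∈T = inj₁ (inj₁ (h∈T , λ h≡e → e≢f (trans (sym h≡e) (x∉p-y∪⁅z⁆⇒x≡y h∉T′ h∈T))))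
    ... | no h∉T  = inj₁ (inj₂ (h∉T , h<e))

    Detour-swap-⊆∩ : ŵ e ≤ ŵ f → Detour ((T - f) ∪ ⁅ g ⁆) e ⊆ ((Detour T e ∩ Detour T f) +ₑ g)
    Detour-swap-⊆∩ e≤f (inj₁ (h∈T′ , h≢e)) with x∈p-y∪⁅z⁆⁻ h∈T′
    ... | inj₁ (h∈T , h≢f) = inj₁ (inj₁ (h∈T , h≢e) , inj₁ (h∈T , h≢f))
    ... | inj₂ h≡g         = inj₂ h≡g
    Detour-swap-⊆∩ {T = T} e≤f {h} (inj₂ (h∉T′ , h<e)) with h ∈? T
    ... | no h∉T  = inj₁ (inj₂ (h∉T , h<e) , inj₂ (h∉T , <-≤-trans h<e e≤f))
    ... | yes h∈T with x∉p-y∪⁅z⁆⇒x≡y h∉T′ h∈T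
    ...   | refl = ⊥-elim (<-irrefl refl (<-≤-trans h<e e≤f))

    swap-lightest-in-cut : ∀ {vs} → Invariant T U → f ∈ U → joins g x y → Walk G T x y es vs → Unique vs →
                           f ∈ₗ es → e ∈ T → e ≢ f → e ∈ U → (e ∈ₗ es → ŵ e ≤ ŵ f) →
                           LightestInCut ((T - f) ∪ ⁅ g ⁆) e
    swap-lightest-in-cut {T = T} {f = f} {x = x} {y = y} {es = es} {e = e}
                         I f∈U jg w uniq f∈es e∈T e≢f e∈U maximal je r with any? (e ≟_) es
    ... | no e∉es = I e∈T e∈U je (Reach-absorb jg x~y (Reach-mono (Detour-swap-⊆ (walk-edge∈ w f∈es) e≢f) r))
      where
      x~y : Reach (Detour T e) x y
      x~y = walk⇒Reach w λ h∈T h∈es → inj₁ (h∈T , λ { refl → e∉es h∈es })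
    -- By the invariant for e a detour around e in the new tree must use g; exchanging g
    -- for e gives a detour around f in T from x to y, which the cycle of g closes up.
    ... | yes e∈es = I (walk-edge∈ w f∈es) f∈U (inj₁ refl) (path-bypass w uniq f∈es inj₁ x~y (inj₁ refl))
      where
      common+e⊆Detour-f : ((Detour T e ∩ Detour T f) +ₑ e) ⊆ Detour T f
      common+e⊆Detour-f (inj₁ (_ , k)) = k
      common+e⊆Detour-f (inj₂ refl)    = inj₁ (e∈T , e≢f)
      x~y : Reach (Detour T f) x y
      x~y = Reach-mono common+e⊆Detour-f (Reach-exchange je jg (Reach-mono (Detour-swap-⊆∩ (maximal e∈es)) r)
                                            (I e∈T e∈U je ∘ Reach-mono proj₁))

    step-preserves-invariant : ∀ {w T′ U′} → Invariant T U → Step G ŵ w T U g T′ U′ → Invariant T′ U′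
    step-preserves-invariant I (acceptTree _)              e∈T e∈U′ = I e∈T (x∈p-y⇒x∈p e∈U′)
    step-preserves-invariant I (rejectEmpty _ _)           e∈T e∈U′ = I e∈T (x∈p-y⇒x∈p e∈U′)
    step-preserves-invariant I (rejectHeavy _ _ _ _ _ _)   e∈T e∈U′ = I e∈T (x∈p-y⇒x∈p e∈U′)
    step-preserves-invariant I (acceptSwap f _ f∈U′ (inj₁ f≡g) _ _) e∈T′ e∈U′ = ⊥-elim (x∈p-y⇒x≢y f∈U′ f≡g)
    step-preserves-invariant I (acceptSwap f _ f∈U′ (inj₂ (es , (_ , w , uniq) , f∈es)) maximal _) e∈T′ e∈U′
      with x∈p-y∪⁅z⁆⁻ e∈T′
    ... | inj₂ e≡g         = ⊥-elim (x∈p-y⇒x≢y e∈U′ e≡g)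
    ... | inj₁ (e∈T , e≢f) =
      swap-lightest-in-cut I (x∈p-y⇒x∈p f∈U′) (inj₁ refl) w uniq f∈es e∈T e≢f (x∈p-y⇒x∈p e∈U′)
        λ e∈es → maximal _ e∈U′ (inj₂ (es , (_ , w , uniq) , e∈es))

    run-invariant : ∀ {w π T₀ k} → Run G ŵ w π T₀ k T U → Invariant T U
    run-invariant (start mst)    e∈T _ = mst-lightest-in-cut mst e∈T
    run-invariant (step run _ s) = step-preserves-invariant (run-invariant run) s

    invariant⇒cycle-bound : Invariant T U → e ∈ U → f ∉ T → OnCycle G T f e → ŵ e ≤ ŵ f
    invariant⇒cycle-bound I e∈U f∉T (inj₁ refl) = ≤-refl
    invariant⇒cycle-bound I e∈U f∉T (inj₂ (_ , (_ , w , uniq) , e∈es)) = ≮⇒≥ λ f<e →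
      I (walk-edge∈ w e∈es) e∈U (inj₁ refl)
        (path-bypass w uniq e∈es inj₁ (return (_ , inj₂ (f∉T , f<e) , inj₁ refl)) (inj₁ refl))

mainTheorem12 : ∀ {n m} (G : SimpleGraph n m) → Connected G →
    (ŵ w : Fin m → ℚ) → (∀ i → 0ℚ < ŵ i) → (∀ i → 0ℚ < w i) →
    (π : Fin m → Fin m) → Injective _≡_ _≡_ π →
    ∀ (T₀ : Subset m) (k : ℕ) (T U : Subset m) → Run G ŵ w π T₀ k T U →
    ∀ (e e' : Fin m) → e ∈ T₀ → e ∈ U → e' ∉ T → OnCycle G T e' e →
    ŵ e ≤ ŵ e'
mainTheorem12 G _ ŵ _ _ _ _ _ _ _ _ _ run _ _ _ e∈U e'∉T onCycle =
  invariant⇒cycle-bound G ŵ (run-invariant G ŵ run) e∈U e'∉T onCycle
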